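{- Let $d,l\ge 1$ be integers, let $n_1,\dots,n_d$ be positive integers, and let $M\subset\mathcal{P}([d])$ be non-empty. If $A\subset[n_1]\times\dots\times[n_d]$ satisfies $\mathrm{c}_M(A)=l$, then there are at most $(|M|\,l^d)^l$ $l$-tuples $(S_1,\dots,S_l)$ such that each $S_i$ is an $M$-subspace and $A\subset S_1\cup\dots\cup S_l$.
   Context: $[k]=\{1,\dots,k\}$. For $B \subset [d]$, a $B$-subspace is a maximal subset $S$ of $[n_1]\times\dots\times[n_d]$ such that $x_i = y_i$ whenever $x,y\in S$ and $i \notin B$. For non-empty $M\subset\mathcal{P}([d])$, an $M$-subspace is a $B$-subspace for some $B\in M$. The $M$-covering number $\mathrm{c}_M(A)$ of $A\subset[n_1]\times\dots\times[n_d]$ is the smallest nonnegative integer $k$ such that $A$ is contained in a union of $k$ $M$-subspaces. -}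

module Defs where

open import Data.Nat using (ℕ; _<_)
open import Data.Bool using (Bool; true; false)
open import Data.Fin using (Fin)
open import Data.Fin.Subset using (Subset; _∈_; _∉_)
open import Data.List using (List)
open import Data.List.Membership.Propositional using () renaming (_∈_ to _∈ₗ_)
open import Data.Product using (Σ; ∃; _×_)
open import Relation.Binary.PropositionalEquality using (_≡_)
open import Relation.Nullary using (¬_)
open import Function.Bundles using (_⇔_)

-- The grid [n₁] × … × [n_d]; coordinate i ranges over Fin (n i) (0-based).
Point : {d : ℕ} → (Fin d → ℕ) → Set
Point {d} n = (i : Fin d) → Fin (n i)

GridSet : {d : ℕ} → (Fin d → ℕ) → Set
GridSet n = Point n → Bool

_∈G_ : {d : ℕ} {n : Fin d → ℕ} → Point n → GridSet n → Set
x ∈G S = S x ≡ true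

_≐_ : {d : ℕ} {n : Fin d → ℕ} → GridSet n → GridSet n → Set
S ≐ T = ∀ x → S x ≡ T x

IsSubspace : {d : ℕ} {n : Fin d → ℕ} → Subset d → GridSet n → Set
IsSubspace {d} {n} B S =
  Σ (Point n) λ x → ∀ (y : Point n) → (y ∈G S) ⇔ (∀ i → i ∉ B → y i ≡ x i)

IsMSubspace : {d : ℕ} {n : Fin d → ℕ} → List (Subset d) → GridSet n → Set
IsMSubspace M S = Σ (Subset _) λ B → (B ∈ₗ M) × IsSubspace B S

IsMCover : {d : ℕ} {n : Fin d → ℕ} → List (Subset d) → GridSet n →
           {k : ℕ} → (Fin k → GridSet n) → Set
IsMCover {n = n} M A {k} Ss =
  (∀ j → IsMSubspace M (Ss j)) ×
  (∀ (x : Point n) → x ∈G A → Σ (Fin k) λ j → x ∈G Ss j)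

CoveringNumberIs : {d : ℕ} {n : Fin d → ℕ} → List (Subset d) → GridSet n → ℕ → Set
CoveringNumberIs {n = n} M A l =
  (Σ (Fin l → GridSet n) λ Ss → IsMCover M A Ss) ×
  (∀ k → k < l → ¬ (Σ (Fin k → GridSet n) λ Ss → IsMCover M A Ss))

_≐ᵗ_ : {d : ℕ} {n : Fin d → ℕ} {l : ℕ} → (Fin l → GridSet n) → (Fin l → GridSet n) → Set
Ss ≐ᵗ Ts = ∀ j → Ss j ≐ Ts j

-- Fix a point a of A (A is non-empty since c_M(A) ≥ 1). In every M-covering
-- (S₁,…,S_l) of A some S_j contains a, and then S_j is the unique B-subspace
-- through a for some B ∈ M. Grouping the coverings by the label (j, B), the
-- coverings with a fixed label are determined by the remaining (l-1)-tuple,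
-- which is an M-covering of A minus that subspace; the latter set has
-- covering number at least l-1. So the count F(l) satisfies
-- F(l) ≤ l·|M|·F(l-1), giving F(l) ≤ l!·|M|^l ≤ (|M|·l)^l ≤ (|M|·l^d)^l.
module Submission where

open import Defs
open import Data.Nat using (ℕ; _≤_; _*_; _^_)
open import Data.Fin using (Fin)
open import Data.Fin.Subset using (Subset)
open import Data.List using (List; length; [])
open import Data.List.Relation.Unary.All using (All)
open import Data.List.Relation.Unary.Unique.Propositional using (Unique)
open import Data.List.Relation.Unary.AllPairs using (AllPairs)
open import Relation.Binary.PropositionalEquality using (_≢_)
open import Relation.Nullary using (¬_)

open import Level using (Level)
open import Data.Nat using (zero; suc; _+_; _<_; z≤n; s≤s; _≤?_)
open import Data.Nat.Properties
open import Data.Bool using (true; false; _∧_; not)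
import Data.Bool as Bool
open import Data.Bool.Properties using (T-≡; ⇔→≡; ¬-not)
open import Data.Fin using (punchIn; punchOut) renaming (zero to fzero; suc to fsuc)
open import Data.Fin.Properties using (all?; punchIn-punchOut) renaming (_≟_ to _≟ᶠ_)
open import Data.Fin.Subset using (_∉_)
open import Data.Fin.Subset.Properties using (_∈?_)
open import Data.Vec.Functional using (removeAt) renaming (_∷_ to _∷ᵛ_)
import Data.Vec.Properties as Vec
open import Data.List using (_∷_; _++_; map; filter; allFin; cartesianProduct)
open import Data.List.Properties using (length-map; length-++; length-tabulate)
open import Data.List.Membership.Propositional using (_∈_)
open import Data.List.Membership.Propositional.Properties
  using (∈-allFin; ∈-cartesianProduct⁺; ∈-cartesianProduct⁻)
open import Data.List.Relation.Unary.All using ([]; _∷_)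
import Data.List.Relation.Unary.All as All
import Data.List.Relation.Unary.All.Properties as All
open import Data.List.Relation.Unary.AllPairs using ([]; _∷_)
import Data.List.Relation.Unary.AllPairs.Properties as AllPairs
open import Data.List.Relation.Unary.Any using (here; there)
open import Data.Product using (Σ; ∃; _×_; _,_; proj₁; proj₂)
open import Data.Product.Properties using (≡-dec)
open import Relation.Nullary using (yes; no; ¬?; contradiction)
open import Relation.Nullary.Decidable using (⌊_⌋; _→-dec_; toWitness; fromWitness; decidable-stable)
open import Relation.Unary using (Pred; Decidable)
open import Relation.Unary.Properties using (∁?)
open import Relation.Binary using (Rel)
open import Relation.Binary.Definitions using (DecidableEquality)
open import Relation.Binary.PropositionalEquality
  using (_≡_; refl; sym; trans; cong; cong₂; subst; module ≡-Reasoning)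
open import Function using (_∘_; id)
open import Function.Bundles using (_⇔_; mk⇔; Equivalence)

private
  variable
    a b p q ℓ : Level
    A : Set a
    B : Set b

length-filter+filter-∁ : {P : Pred A p} (P? : Decidable P) (xs : List A) →
  length (filter P? xs) + length (filter (∁? P?) xs) ≡ length xs
length-filter+filter-∁ P? [] = refl
length-filter+filter-∁ P? (x ∷ xs) with P? x
... | yes _ = cong suc (length-filter+filter-∁ P? xs)
... | no _ = trans (+-suc _ _) (cong suc (length-filter+filter-∁ P? xs))

length-cartesianProduct : (xs : List A) (ys : List B) →
  length (cartesianProduct xs ys) ≡ length xs * length ys
length-cartesianProduct [] ys = refl
length-cartesianProduct (x ∷ xs) ys = begin
  length (map (x ,_) ys ++ cartesianProduct xs ys)
    ≡⟨ length-++ (map (x ,_) ys) ⟩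
  length (map (x ,_) ys) + length (cartesianProduct xs ys)
    ≡⟨ cong₂ _+_ (length-map (x ,_) ys) (length-cartesianProduct xs ys) ⟩
  length ys + length xs * length ys ∎
  where open ≡-Reasoning

length-toList : {P : Pred A p} {xs : List A} (pxs : All P xs) → length (All.toList pxs) ≡ length xs
length-toList [] = refl
length-toList (_ ∷ pxs) = cong suc (length-toList pxs)

AllPairs-toList : {P : Pred A p} {R : Rel A ℓ} {S : Rel (∃ P) q} →
  (∀ {x y} (px : P x) (py : P y) → R x y → S (x , px) (y , py)) →
  {xs : List A} {pxs : All P xs} → AllPairs R xs → AllPairs S (All.toList pxs)
AllPairs-toList f {pxs = []} [] = []
AllPairs-toList {P = P} {R} {S} f {pxs = px ∷ pxs} (Rx ∷ Rxs) =
  All-toList pxs Rx ∷ AllPairs-toList f Rxs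
  where
  All-toList : ∀ {x ys} {px : P x} (pys : All P ys) →
    All (R x) ys → All (S (x , px)) (All.toList pys)
  All-toList [] [] = []
  All-toList (py ∷ pys) (r ∷ rs) = f _ py r ∷ All-toList pys rs

module _ {Y C : Set} (_≟_ : DecidableEquality C) (κ : Y → C) {R : Rel Y ℓ} {b : ℕ} where

  length-≤-fibres : (cs : List C) {ys : List Y} → All (λ y → κ y ∈ cs) ys → AllPairs R ys →
    (∀ {c zs} → c ∈ cs → All (λ z → κ z ≡ c) zs → AllPairs R zs → length zs ≤ b) →
    length ys ≤ length cs * b
  length-≤-fibres [] {[]} _ _ _ = z≤n
  length-≤-fibres [] {_ ∷ _} (() ∷ _) _ _
  length-≤-fibres (c ∷ cs) {ys} labels apart fibre = begin
    length ys
      ≡⟨ sym (length-filter+filter-∁ is-c? ys) ⟩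
    length (filter is-c? ys) + length (filter (∁? is-c?) ys)
      ≤⟨ +-mono-≤ (fibre (here refl) (All.all-filter is-c? ys) (AllPairs.filter⁺ is-c? apart))
                  (length-≤-fibres cs other-labels (AllPairs.filter⁺ (∁? is-c?) apart)
                                   (fibre ∘ there)) ⟩
    b + length cs * b ∎
    where
    open ≤-Reasoning
    is-c? : Decidable (λ y → κ y ≡ c)
    is-c? y = κ y ≟ c
    drop-c : ∀ {y} → κ y ≢ c × κ y ∈ c ∷ cs → κ y ∈ cs
    drop-c (κy≢c , here κy≡c) = contradiction κy≡c κy≢c
    drop-c (_ , there κy∈cs) = κy∈cs
    other-labels : All (λ y → κ y ∈ cs) (filter (∁? is-c?) ys)
    other-labels =
      All.zipWith drop-c (All.all-filter (∁? is-c?) ys , All.filter⁺ (∁? is-c?) labels)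

module _ {d : ℕ} {n : Fin d → ℕ} where

  subspaceThrough : Subset d → Point n → GridSet n
  subspaceThrough B a y = ⌊ all? (λ i → ¬? (i ∈? B) →-dec y i ≟ᶠ a i) ⌋

  ∈-subspaceThrough : ∀ B a y → y ∈G subspaceThrough B a ⇔ (∀ i → i ∉ B → y i ≡ a i)
  ∈-subspaceThrough B a y =
    mk⇔ (toWitness ∘ Equivalence.from T-≡) (Equivalence.to T-≡ ∘ fromWitness)

  subspaceThrough-isSubspace : ∀ B a → IsSubspace B (subspaceThrough B a)
  subspaceThrough-isSubspace B a = a , ∈-subspaceThrough B a

  subspace-≐-subspaceThrough : ∀ {B S a} → IsSubspace B S → a ∈G S → S ≐ subspaceThrough B a
  subspace-≐-subspaceThrough {B} {S} {a} (x , ∈S) a∈S y = ⇔→≡ (mk⇔ to from)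
    where
    a≡x : ∀ i → i ∉ B → a i ≡ x i
    a≡x = Equivalence.to (∈S a) a∈S
    to : y ∈G S → y ∈G subspaceThrough B a
    to y∈S = Equivalence.from (∈-subspaceThrough B a y) λ i i∉B →
      trans (Equivalence.to (∈S y) y∈S i i∉B) (sym (a≡x i i∉B))
    from : y ∈G subspaceThrough B a → y ∈G S
    from y∈ = Equivalence.from (∈S y) λ i i∉B →
      trans (Equivalence.to (∈-subspaceThrough B a y) y∈ i i∉B) (a≡x i i∉B)

  _∖_ : GridSet n → GridSet n → GridSet n
  (A ∖ S) x = A x ∧ not (S x)

  ∈-∖⁺ : ∀ {A S x} → x ∈G A → ¬ x ∈G S → x ∈G (A ∖ S)
  ∈-∖⁺ x∈A x∉S rewrite x∈A | ¬-not x∉S = refl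

  ∈-∖⁻ : ∀ {A S x} → x ∈G (A ∖ S) → x ∈G A × ¬ x ∈G S
  ∈-∖⁻ {A} {S} {x} x∈A∖S with A x | S x
  ... | true | false = refl , λ ()

  ≐ᵗ-removeAt : ∀ {l} {T T' : Fin (suc l) → GridSet n} {j} →
    T j ≐ T' j → removeAt T j ≐ᵗ removeAt T' j → T ≐ᵗ T'
  ≐ᵗ-removeAt {T = T} {T'} {j} Tj≐T'j rest≐ k with j ≟ᶠ k
  ... | yes refl = Tj≐T'j
  ... | no j≢k = subst (λ k → T k ≐ T' k) (punchIn-punchOut j≢k) (rest≐ (punchOut j≢k))

coverBound : ℕ → ℕ → ℕ
coverBound m zero = 1
coverBound m (suc r) = (suc r * m) * coverBound m r

coverBound-≤ : ∀ m r → coverBound m r ≤ (m * r) ^ r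
coverBound-≤ m zero = ≤-refl
coverBound-≤ m (suc r) = begin
  (suc r * m) * coverBound m r ≤⟨ *-mono-≤ (≤-reflexive (*-comm (suc r) m)) bound ⟩
  (m * suc r) * (m * suc r) ^ r ∎
  where
  open ≤-Reasoning
  bound : coverBound m r ≤ (m * suc r) ^ r
  bound = ≤-trans (coverBound-≤ m r) (^-monoˡ-≤ r (*-monoʳ-≤ m (n≤1+n r)))

n≤n^m : ∀ n {m} → 1 ≤ m → n ≤ n ^ m
n≤n^m zero {suc m} _ = z≤n
n≤n^m (suc n) {suc m} _ = begin
  suc n ≡⟨ sym (*-identityʳ (suc n)) ⟩
  suc n * 1 ≤⟨ *-monoʳ-≤ (suc n) (m^n>0 (suc n) m) ⟩
  suc n * suc n ^ m ∎
  where open ≤-Reasoning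

module _ {d : ℕ} {n : Fin d → ℕ} (M : List (Subset d)) where

  Cover : GridSet n → ℕ → Set
  Cover A r = Σ (Fin r → GridSet n) (IsMCover M A)

  Apart : ∀ {A r} → Cover A r → Cover A r → Set
  Apart c c' = ¬ (proj₁ c ≐ᵗ proj₁ c')

  NoCoverBelow : ℕ → GridSet n → Set
  NoCoverBelow r A = ∀ k → k < r → ¬ Cover A k

  noCoverBelow-nonEmpty : ∀ {r A} → NoCoverBelow (suc r) A → ¬ ¬ ∃ (_∈G A)
  noCoverBelow-nonEmpty noBelow empty =
    noBelow 0 (s≤s z≤n) ((λ ()) , (λ ()) , λ x x∈A → contradiction (x , x∈A) empty)

  cover-∷ : ∀ {A S k} {U : Fin k → GridSet n} →
    IsMSubspace M S → IsMCover M (A ∖ S) U → IsMCover M A (S ∷ᵛ U)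
  cover-∷ {A} {S} {k} {U} S-sub (U-sub , U-cov) = sub , cov
    where
    sub : ∀ i → IsMSubspace M ((S ∷ᵛ U) i)
    sub fzero = S-sub
    sub (fsuc i) = U-sub i
    cov : ∀ x → x ∈G A → Σ (Fin (suc k)) λ i → x ∈G (S ∷ᵛ U) i
    cov x x∈A with S x Bool.≟ true
    ... | yes x∈S = fzero , x∈S
    ... | no x∉S = let (i , x∈Ui) = U-cov x (∈-∖⁺ {A = A} {S = S} x∈A x∉S) in fsuc i , x∈Ui

  noCoverBelow-∖ : ∀ {r A S} → NoCoverBelow (suc r) A → IsMSubspace M S → NoCoverBelow r (A ∖ S)
  noCoverBelow-∖ noBelow S-sub k k<r (U , U-cover) =
    noBelow (suc k) (s≤s k<r) (_ , cover-∷ S-sub U-cover)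

  cover-removeAt : ∀ {A S l} {T : Fin (suc l) → GridSet n} {j} →
    IsMCover M A T → T j ≐ S → IsMCover M (A ∖ S) (removeAt T j)
  cover-removeAt {A} {S} {l} {T} {j} (T-sub , T-cov) Tj≐S = (T-sub ∘ punchIn j) , cov
    where
    cov : ∀ x → x ∈G (A ∖ S) → Σ (Fin l) λ k → x ∈G T (punchIn j k)
    cov x x∈A∖S with ∈-∖⁻ {A = A} {S = S} x∈A∖S
    ... | x∈A , x∉S with T-cov x x∈A
    ... | k , x∈Tk with j ≟ᶠ k
    ... | yes refl = contradiction (trans (sym (Tj≐S x)) x∈Tk) x∉S
    ... | no j≢k = punchOut j≢k , subst (λ k → x ∈G T k) (sym (punchIn-punchOut j≢k)) x∈Tk

  CoverCountBound : ℕ → Set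
  CoverCountBound r = ∀ {A} → NoCoverBelow r A →
    (cs : List (Cover A r)) → AllPairs Apart cs → length cs ≤ coverBound (length M) r

  module LabelThrough {r : ℕ} {A : GridSet n} (a : Point n) (a∈A : a ∈G A) where

    Labels : List (Fin (suc r) × Subset d)
    Labels = cartesianProduct (allFin (suc r)) M

    label : Cover A (suc r) → Fin (suc r) × Subset d
    label (T , T-sub , T-cov) = let j = proj₁ (T-cov a a∈A) in j , proj₁ (T-sub j)

    label-∈ : ∀ c → label c ∈ Labels
    label-∈ (T , T-sub , T-cov) = ∈-cartesianProduct⁺ (∈-allFin _) (proj₁ (proj₂ (T-sub _)))

    labelled : ∀ {j B} (c : Cover A (suc r)) → label c ≡ (j , B) → proj₁ c j ≐ subspaceThrough B a
    labelled (T , T-sub , T-cov) refl =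
      subspace-≐-subspaceThrough (proj₂ (proj₂ (T-sub _))) (proj₂ (T-cov a a∈A))

    restrict : ∀ {j B} → Σ (Cover A (suc r)) (λ c → label c ≡ (j , B)) →
      Cover (A ∖ subspaceThrough B a) r
    restrict {j} ((T , T-cover) , e) =
      removeAt T j , cover-removeAt T-cover (labelled (T , T-cover) e)

    restrict-apart : ∀ {j B c c'} (e : label c ≡ (j , B)) (e' : label c' ≡ (j , B)) →
      Apart c c' → Apart (restrict (c , e)) (restrict (c' , e'))
    restrict-apart {c = c} {c'} e e' c#c' rest≐ =
      c#c' (≐ᵗ-removeAt (λ x → trans (labelled c e x) (sym (labelled c' e' x))) rest≐)

    fibre-≤ : CoverCountBound r → NoCoverBelow (suc r) A →
      ∀ {jB zs} → jB ∈ Labels → All (λ z → label z ≡ jB) zs → AllPairs Apart zs →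
      length zs ≤ coverBound (length M) r
    fibre-≤ IH noBelow {j , B} {zs} jB∈Labels labels apart = begin
      length zs
        ≡⟨ sym (trans (length-map restrict (All.toList labels)) (length-toList labels)) ⟩
      length (map restrict (All.toList labels))
        ≤⟨ IH (noCoverBelow-∖ noBelow (B , B∈M , subspaceThrough-isSubspace B a))
              (map restrict (All.toList labels))
              (AllPairs.map⁺ {f = restrict}
                (AllPairs-toList (λ {c} {c'} → restrict-apart {c = c} {c'}) {pxs = labels} apart)) ⟩
      coverBound (length M) r ∎
      where
      open ≤-Reasoning
      B∈M : B ∈ M
      B∈M = proj₂ (∈-cartesianProduct⁻ (allFin (suc r)) M jB∈Labels)

  coverCount-≤ : ∀ r → CoverCountBound r
  coverCount-≤ zero _ [] _ = z≤n
  coverCount-≤ zero _ (_ ∷ []) _ = s≤s z≤n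
  coverCount-≤ zero _ (_ ∷ _ ∷ _) ((c#c' ∷ _) ∷ _) = contradiction (λ ()) c#c'
  -- A point of A exists only classically (¬ ¬); the decidable goal is stable.
  coverCount-≤ (suc r) {A} noBelow cs apart =
    decidable-stable (_ ≤? _) λ cs≰ →
      noCoverBelow-nonEmpty noBelow λ (a , a∈A) → cs≰ (through a a∈A)
    where
    through : ∀ a → a ∈G A → length cs ≤ coverBound (length M) (suc r)
    through a a∈A = begin
      length cs
        ≤⟨ length-≤-fibres (≡-dec _≟ᶠ_ (Vec.≡-dec Bool._≟_)) label Labels
             (All.universal label-∈ cs) apart (fibre-≤ (coverCount-≤ r) noBelow) ⟩
      length Labels * coverBound (length M) r
        ≡⟨ cong (_* coverBound (length M) r)
             (trans (length-cartesianProduct (allFin (suc r)) M)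
                    (cong (_* length M) (length-tabulate {n = suc r} (λ i → i)))) ⟩
      (suc r * length M) * coverBound (length M) r ∎
      where
      open ≤-Reasoning
      open LabelThrough {r} {A} a a∈A

theorem2p5 : (d l : ℕ) → 1 ≤ d → 1 ≤ l →
    (n : Fin d → ℕ) → (∀ i → 1 ≤ n i) →
    (M : List (Subset d)) → Unique M → M ≢ [] →
    (A : GridSet n) → CoveringNumberIs M A l →
    (ts : List (Fin l → GridSet n)) →
    All (IsMCover M A) ts →
    AllPairs (λ Ss Ts → ¬ (Ss ≐ᵗ Ts)) ts →
    length ts ≤ (length M * l ^ d) ^ l
theorem2p5 d l 1≤d _ n _ M _ _ A (_ , noBelow) ts covers apart = begin
  length ts
    ≡⟨ sym (length-toList covers) ⟩
  length (All.toList covers)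
    ≤⟨ coverCount-≤ M l noBelow (All.toList covers)
         (AllPairs-toList (λ _ _ → id) {pxs = covers} apart) ⟩
  coverBound (length M) l
    ≤⟨ coverBound-≤ (length M) l ⟩
  (length M * l) ^ l
    ≤⟨ ^-monoˡ-≤ l (*-monoʳ-≤ (length M) (n≤n^m l 1≤d)) ⟩
  (length M * l ^ d) ^ l ∎
  where open ≤-Reasoning
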